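{- Let $n$ be a prime number and let $s=(s_1,\dots,s_n)\in(\mathbb{Z}/n\mathbb{Z})^n$ with $s_1+\dots+s_n=0$. Suppose that $s$ is not of the form $(\sigma(0)+j,\sigma(1)+j,\dots,\sigma(n-1)+j)$ up to reordering, i.e. that the class of $s$ modulo the simultaneous actions of $\mathbb{Z}/n\mathbb{Z}$ and $\mathfrak{S}_n$ is not the class of $(0,1,2,\dots,n-1)$. Then the number $\gamma(s)$ of distinct permutations of $(s_1,\dots,s_n)$ is equal to the number of distinct permutations of the class $[s]$ of $s$ modulo $\mathbb{Z}/n\mathbb{Z}$.
   Context: The group $\mathbb{Z}/n\mathbb{Z}$ acts on tuples $(s_1,\dots,s_n)\in(\mathbb{Z}/n\mathbb{Z})^n$ with $\sum s_i=0$ by $j\cdot(s_1,\dots,s_n)=(s_1+j,\dots,s_n+j)$, and $\mathfrak{S}_n$ acts by permuting coordinates: ${}^\sigma(s_1,\dots,s_n)=(s_{\sigma^{ -1}(1)},\dots,s_{\sigma^{ -1}(n)})$. $[s]$ denotes the orbit of $s$ under $\mathbb{Z}/n\mathbb{Z}$. The number of distinct permutations of $[s]$ is the number of distinct classes $[{}^\sigma s]$, $\sigma\in\mathfrak{S}_n$. $\gamma(s)$ is the number of distinct tuples ${}^\sigma s$, $\sigma\in\mathfrak{S}_n$. -}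

module Defs where

open import Data.Nat using (ℕ; zero; suc; _+_; _%_)
open import Data.Nat.DivMod using (m%n<n)
open import Data.Fin using (Fin; toℕ; fromℕ<)
open import Data.Fin.Permutation using (Permutation′; _⟨$⟩ˡ_)
open import Data.List using (map; allFin)
open import Data.Nat.ListAction using (sum)
open import Data.Product using (Σ; ∃; _×_; _,_; proj₁)
open import Relation.Binary.PropositionalEquality using (_≡_)

-- Z/nZ is represented by Fin n; addition modulo n.
-- (For n = 0 the type Fin 0 is empty, so there is nothing to define.)
_⊕_ : ∀ {n} → Fin n → Fin n → Fin n
_⊕_ {suc m} a b = fromℕ< (m%n<n (toℕ a + toℕ b) (suc m))

-- n-tuples with entries in Z/nZ, indexed by Fin n (coordinate i ↔ s_{i+1})
Tuple : ℕ → Set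
Tuple n = Fin n → Fin n

_≈ₜ_ : ∀ {n} → Tuple n → Tuple n → Set
s ≈ₜ t = ∀ i → s i ≡ t i

-- the sum s_1 + ... + s_n computed in ℕ (its residue mod n is the sum in Z/nZ)
tupleSum : ∀ {n} → Tuple n → ℕ
tupleSum {n} s = sum (map (λ i → toℕ (s i)) (allFin n))

-- the S_n action: (^σ s)_i = s_{σ⁻¹(i)}
permute : ∀ {n} → Permutation′ n → Tuple n → Tuple n
permute σ s i = s (σ ⟨$⟩ˡ i)

shift : ∀ {n} → Fin n → Tuple n → Tuple n
shift j s i = s i ⊕ j

standard : ∀ {n} → Tuple n
standard i = i

_∼ₙ_ : ∀ {n} → Tuple n → Tuple n → Set
s ∼ₙ t = ∃ λ j → shift j s ≈ₜ t

PermsOf : ∀ {n} → Tuple n → Set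
PermsOf {n} s = Σ (Tuple n) λ t → ∃ λ (σ : Permutation′ n) → t ≈ₜ permute σ s

-- A has exactly k distinct elements w.r.t. the relation R:
-- an enumeration Fin k → A that is injective and surjective up to R.
HasSize : ∀ {A : Set} → (A → A → Set) → ℕ → Set
HasSize {A} R k =
  Σ (Fin k → A) λ f →
    (∀ a b → R (f a) (f b) → a ≡ b) × (∀ x → ∃ λ a → R (f a) x)

γ-is : ∀ {n} → Tuple n → ℕ → Set
γ-is s k = HasSize {PermsOf s} (λ t u → proj₁ t ≈ₜ proj₁ u) k

classPerms-is : ∀ {n} → Tuple n → ℕ → Set
classPerms-is s k = HasSize {PermsOf s} (λ t u → proj₁ t ∼ₙ proj₁ u) k

module Submission where

-- Both counts in the theorem enumerate the same set PermsOf s of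
-- rearrangements of s: γ(s) up to equality of tuples, the number of
-- classes up to a simultaneous shift by some c ∈ Z/nZ.  Equal tuples are
-- related by the shift 0.  Conversely, suppose ^σ s shifted by c ≠ 0 is
-- ^τ s.  Then s ∘ π = s ⊕ c for the permutation π = τ⁻¹σ, so along the
-- orbit 0, π 0, π² 0, … the values of s run through the arithmetic
-- progression s₀, s₀ + c, s₀ + 2c, … , whose first n terms are distinct
-- because n is prime.  Hence s is injective, i.e. a rearrangement of
-- (0, 1, …, n-1), which the hypothesis excludes.  So on PermsOf s the two
-- relations agree, and two exact enumerations of one set with respect to
-- one relation have the same length.

open import Defs
open import Data.Nat using (ℕ; zero; suc; _+_; _*_; _∸_; _%_; _/_; _<_; NonZero; >-nonZero; ≢-nonZero)
open import Data.Nat.Properties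
open import Data.Nat.DivMod using (m%n<n; m≡m%n+[m/n]*n; m<n⇒m%n≡m; %-distribˡ-+; m%n%n≡m%n)
open import Data.Nat.Divisibility using (_∣_; divides; ∣m+n∣m⇒∣n; n∣m*n; ∣⇒≤)
open import Data.Nat.Primality using (Prime; euclidsLemma; prime⇒nonZero)
open import Data.Fin as Fin using (Fin; toℕ; punchOut)
open import Data.Fin.Properties using (toℕ-fromℕ<; toℕ-injective; toℕ<n; any?; punchOut-injective; injective⇒≤; cantor-schröder-bernstein)
open import Data.Fin.Permutation using (Permutation′; _⟨$⟩ˡ_; _⟨$⟩ʳ_; permutation; inverseˡ; inverseʳ)
open import Data.Product using (Σ; ∃; ∃₂; _,_; proj₁; proj₂)
open import Data.Sum using ([_,_]′)
open import Data.Empty using (⊥-elim)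
open import Function.Definitions using (Injective)
open import Relation.Binary.Definitions using (Symmetric; Transitive; tri<; tri≈; tri>)
open import Relation.Nullary using (¬_; yes; no)
open import Relation.Binary.PropositionalEquality using (_≡_; _≢_; refl; sym; trans; cong; subst; module ≡-Reasoning)

toℕ-⊕ : ∀ {n} (a b : Fin (suc n)) → toℕ (a ⊕ b) ≡ (toℕ a + toℕ b) % suc n
toℕ-⊕ {n} a b = toℕ-fromℕ< (m%n<n (toℕ a + toℕ b) (suc n))

⊕-identityʳ : ∀ {n} (a : Fin (suc n)) → a ⊕ Fin.zero ≡ a
⊕-identityʳ {n} a = toℕ-injective (begin
  toℕ (a ⊕ Fin.zero)   ≡⟨ toℕ-⊕ a Fin.zero ⟩
  (toℕ a + 0) % suc n  ≡⟨ cong (_% suc n) (+-identityʳ (toℕ a)) ⟩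
  toℕ a % suc n        ≡⟨ m<n⇒m%n≡m (toℕ<n a) ⟩
  toℕ a                ∎)
  where open ≡-Reasoning

[m%d+n]%d≡[m+n]%d : ∀ m n d .{{_ : NonZero d}} → (m % d + n) % d ≡ (m + n) % d
[m%d+n]%d≡[m+n]%d m n d = begin
  (m % d + n) % d          ≡⟨ %-distribˡ-+ (m % d) n d ⟩
  (m % d % d + n % d) % d  ≡⟨ cong (λ x → (x + n % d) % d) (m%n%n≡m%n m d) ⟩
  (m % d + n % d) % d      ≡⟨ sym (%-distribˡ-+ m n d) ⟩
  (m + n) % d              ∎
  where open ≡-Reasoning

-- If adding n leaves m unchanged modulo d, then d divides n: both m and
-- m + n are m % d plus a multiple of d, so n is a difference of multiples.
[m+n]%d≡m%d⇒d∣n : ∀ m n d .{{_ : NonZero d}} → (m + n) % d ≡ m % d → d ∣ n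
[m+n]%d≡m%d⇒d∣n m n d eq =
  ∣m+n∣m⇒∣n (divides ((m + n) / d) (+-cancelˡ-≡ (m % d) _ _ decompose)) (n∣m*n (m / d))
  where
  open ≡-Reasoning
  decompose : m % d + ((m / d) * d + n) ≡ m % d + ((m + n) / d) * d
  decompose = begin
    m % d + ((m / d) * d + n)        ≡⟨ sym (+-assoc (m % d) _ n) ⟩
    m % d + (m / d) * d + n          ≡⟨ cong (_+ n) (sym (m≡m%n+[m/n]*n m d)) ⟩
    m + n                            ≡⟨ m≡m%n+[m/n]*n (m + n) d ⟩
    (m + n) % d + ((m + n) / d) * d  ≡⟨ cong (_+ ((m + n) / d) * d) eq ⟩
    m % d + ((m + n) / d) * d        ∎

-- Modulo a prime N, a later term a + r′c (r′ < N) of an arithmetic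
-- progression with step c ≢ 0 never repeats an earlier term a + rc:
-- otherwise N ∣ (r′ - r)c with 0 < r′ - r < N, against Euclid's lemma.
progression-no-repeat : ∀ {N} .{{_ : NonZero N}} → Prime N → ∀ a c → ¬ N ∣ c →
  ∀ {r r′} → r < r′ → r′ < N → (a + r * c) % N ≢ (a + r′ * c) % N
progression-no-repeat {N} isPrime a c N∤c {r} {r′} r<r′ r′<N eq =
  [ N∤gap , N∤c ]′ (euclidsLemma (r′ ∸ r) c isPrime N∣gap*c)
  where
  open ≡-Reasoning
  N∤gap : ¬ N ∣ r′ ∸ r
  N∤gap N∣gap = <⇒≱ (≤-<-trans (m∸n≤m r′ r) r′<N) (∣⇒≤ {{>-nonZero (m<n⇒0<n∸m r<r′)}} N∣gap)
  later-term : a + r′ * c ≡ a + r * c + (r′ ∸ r) * c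
  later-term = begin
    a + r′ * c                 ≡⟨ cong (λ x → a + x * c) (sym (m+[n∸m]≡n (<⇒≤ r<r′))) ⟩
    a + (r + (r′ ∸ r)) * c     ≡⟨ cong (a +_) (*-distribʳ-+ c r (r′ ∸ r)) ⟩
    a + (r * c + (r′ ∸ r) * c) ≡⟨ sym (+-assoc a (r * c) _) ⟩
    a + r * c + (r′ ∸ r) * c   ∎
  N∣gap*c : N ∣ (r′ ∸ r) * c
  N∣gap*c = [m+n]%d≡m%d⇒d∣n (a + r * c) ((r′ ∸ r) * c) N
              (trans (cong (_% N) (sym later-term)) (sym eq))

progression-injective : ∀ {N} .{{_ : NonZero N}} → Prime N → ∀ a c → ¬ N ∣ c →
  ∀ {r r′} → r < N → r′ < N → (a + r * c) % N ≡ (a + r′ * c) % N → r ≡ r′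
progression-injective isPrime a c N∤c {r} {r′} r<N r′<N eq with <-cmp r r′
... | tri< r<r′ _ _ = ⊥-elim (progression-no-repeat isPrime a c N∤c r<r′ r′<N eq)
... | tri≈ _ r≡r′ _ = r≡r′
... | tri> _ _ r′<r = ⊥-elim (progression-no-repeat isPrime a c N∤c r′<r r<N (sym eq))

-- Pigeonhole: an injective self-map of Fin n is surjective (a missed
-- value y would let f, punched out at y, inject Fin n into Fin (n - 1)).
injective⇒surjective : ∀ {n} (f : Fin n → Fin n) → Injective _≡_ _≡_ f →
  ∀ y → ∃ λ x → f x ≡ y
injective⇒surjective {zero} f f-inj ()
injective⇒surjective {suc n} f f-inj y with any? (λ x → f x Fin.≟ y)
... | yes hit = hit
... | no miss = ⊥-elim (<-irrefl refl (injective⇒≤ {f = avoid} avoid-injective))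
  where
  y≢f : ∀ x → y ≢ f x
  y≢f x y≡fx = miss (x , sym y≡fx)
  avoid : Fin (suc n) → Fin n
  avoid x = punchOut (y≢f x)
  avoid-injective : Injective _≡_ _≡_ avoid
  avoid-injective {x} {x′} eq = f-inj (punchOut-injective (y≢f x) (y≢f x′) eq)

injective⇒permutation : ∀ {n} (f : Fin n → Fin n) → Injective _≡_ _≡_ f →
  Σ (Permutation′ n) λ σ → ∀ x → σ ⟨$⟩ʳ x ≡ f x
injective⇒permutation f f-inj =
  permutation f preimage (λ y → proj₂ (surjective y)) (λ x → f-inj (proj₂ (surjective (f x)))) ,
  λ _ → refl
  where
  surjective : ∀ y → ∃ λ x → f x ≡ y
  surjective = injective⇒surjective f f-inj
  preimage : Fin _ → Fin _
  preimage y = proj₁ (surjective y)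

-- Along the orbit of 0 under π the
-- values of s form the progression s₀ + rc, whose first n terms are
-- distinct; so the orbit map r ↦ πʳ 0 on Fin n is injective, hence onto,
-- and s is injective on its image, i.e. everywhere.
shift-invariant⇒injective : ∀ {n} → Prime (suc n) → (s π : Tuple (suc n)) (c : Fin (suc n)) →
  c ≢ Fin.zero → (∀ x → s (π x) ≡ s x ⊕ c) → Injective _≡_ _≡_ s
shift-invariant⇒injective {n} isPrime s π c c≢0 shift-invariant = s-injective
  where
  open ≡-Reasoning
  N = suc n
  a = toℕ (s Fin.zero)

  orbit : ℕ → Fin N
  orbit zero    = Fin.zero
  orbit (suc r) = π (orbit r)

  orbit-value : ∀ r → toℕ (s (orbit r)) ≡ (a + r * toℕ c) % N
  orbit-value zero = begin
    a            ≡⟨ sym (m<n⇒m%n≡m (toℕ<n (s Fin.zero))) ⟩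
    a % N        ≡⟨ cong (_% N) (sym (+-identityʳ a)) ⟩
    (a + 0) % N  ∎
  orbit-value (suc r) = begin
    toℕ (s (π (orbit r)))                  ≡⟨ cong toℕ (shift-invariant (orbit r)) ⟩
    toℕ (s (orbit r) ⊕ c)                  ≡⟨ toℕ-⊕ (s (orbit r)) c ⟩
    (toℕ (s (orbit r)) + toℕ c) % N        ≡⟨ cong (λ x → (x + toℕ c) % N) (orbit-value r) ⟩
    ((a + r * toℕ c) % N + toℕ c) % N      ≡⟨ [m%d+n]%d≡[m+n]%d (a + r * toℕ c) (toℕ c) N ⟩
    (a + r * toℕ c + toℕ c) % N            ≡⟨ cong (_% N) (+-assoc a (r * toℕ c) (toℕ c)) ⟩
    (a + (r * toℕ c + toℕ c)) % N          ≡⟨ cong (λ x → (a + x) % N) (+-comm (r * toℕ c) (toℕ c)) ⟩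
    (a + suc r * toℕ c) % N                ∎

  N∤c : ¬ N ∣ toℕ c
  N∤c N∣c = <⇒≱ (toℕ<n c) (∣⇒≤ {{≢-nonZero (λ c≡0 → c≢0 (toℕ-injective c≡0))}} N∣c)

  initial-orbit : Fin N → Fin N
  initial-orbit r = orbit (toℕ r)

  s-on-orbit-injective : Injective _≡_ _≡_ (λ r → s (initial-orbit r))
  s-on-orbit-injective {r} {r′} eq = toℕ-injective
    (progression-injective isPrime a (toℕ c) N∤c (toℕ<n r) (toℕ<n r′)
      (trans (sym (orbit-value (toℕ r))) (trans (cong toℕ eq) (orbit-value (toℕ r′)))))

  orbit-surjective : ∀ x → ∃ λ r → initial-orbit r ≡ x
  orbit-surjective = injective⇒surjective initial-orbit (λ {r} {r′} eq → s-on-orbit-injective {r} {r′} (cong s eq))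

  s-injective : Injective _≡_ _≡_ s
  s-injective {x} {y} eq with orbit-surjective x | orbit-surjective y
  ... | r , refl | r′ , refl = cong initial-orbit (s-on-orbit-injective {r} {r′} eq)

-- If a nonzero shift of ^σ s is ^τ s, then s is a rearrangement of
-- (0, 1, …, n-1): s ∘ (τ⁻¹σ) = s ⊕ c, so s is injective by the orbit
-- argument, hence the forward map of a permutation ρ with ^ρ s = standard.
shifted-rearrangement⇒standard : ∀ {n} → Prime (suc n) → (s : Tuple (suc n))
  (σ τ : Permutation′ (suc n)) (c : Fin (suc n)) → c ≢ Fin.zero →
  shift c (permute σ s) ≈ₜ permute τ s →
  ∃₂ λ (ρ : Permutation′ (suc n)) j → permute ρ s ≈ₜ shift j standard
shifted-rearrangement⇒standard isPrime s σ τ c c≢0 shifted = ρ , Fin.zero , is-standard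
  where
  π : Tuple _
  π x = τ ⟨$⟩ˡ (σ ⟨$⟩ʳ x)

  shift-invariant : ∀ x → s (π x) ≡ s x ⊕ c
  shift-invariant x = trans (sym (shifted (σ ⟨$⟩ʳ x))) (cong (λ y → s y ⊕ c) (inverseˡ σ))

  s-permutation : Σ (Permutation′ _) λ ρ → ∀ x → ρ ⟨$⟩ʳ x ≡ s x
  s-permutation = injective⇒permutation s (shift-invariant⇒injective isPrime s π c c≢0 shift-invariant)

  ρ = proj₁ s-permutation

  is-standard : permute ρ s ≈ₜ shift Fin.zero standard
  is-standard i = begin
    s (ρ ⟨$⟩ˡ i)             ≡⟨ sym (proj₂ s-permutation (ρ ⟨$⟩ˡ i)) ⟩
    ρ ⟨$⟩ʳ (ρ ⟨$⟩ˡ i)        ≡⟨ inverseʳ ρ ⟩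
    i                        ≡⟨ sym (⊕-identityʳ i) ⟩
    i ⊕ Fin.zero             ∎
    where open ≡-Reasoning

equal⇒same-class : ∀ {n} {t u : Tuple (suc n)} → t ≈ₜ u → t ∼ₙ u
equal⇒same-class {t = t} t≈u = Fin.zero , λ i → trans (⊕-identityʳ (t i)) (t≈u i)

same-class⇒equal : ∀ {n} → Prime (suc n) → (s : Tuple (suc n)) →
  ¬ (∃₂ λ (ρ : Permutation′ (suc n)) j → permute ρ s ≈ₜ shift j standard) →
  (p q : PermsOf s) → proj₁ p ∼ₙ proj₁ q → proj₁ p ≈ₜ proj₁ q
same-class⇒equal isPrime s ¬standard (t , σ , t≈) (u , τ , u≈) (Fin.zero , shifted) i =
  trans (sym (⊕-identityʳ (t i))) (shifted i)
same-class⇒equal isPrime s ¬standard (t , σ , t≈) (u , τ , u≈) (Fin.suc j , shifted) =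
  ⊥-elim (¬standard (shifted-rearrangement⇒standard isPrime s σ τ (Fin.suc j) (λ ())
    (λ i → trans (cong (_⊕ Fin.suc j) (sym (t≈ i))) (trans (shifted i) (u≈ i)))))

HasSize-transport : {A : Set} {R R′ : A → A → Set} →
  (∀ {a b} → R a b → R′ a b) → (∀ {a b} → R′ a b → R a b) →
  ∀ {k} → HasSize R k → HasSize R′ k
HasSize-transport R⇒R′ R′⇒R (f , f-injective , f-surjective) =
  f , (λ a b r′ → f-injective a b (R′⇒R r′)) ,
  λ x → proj₁ (f-surjective x) , R⇒R′ (proj₂ (f-surjective x))

reindex : {A : Set} {R : A → A → Set} → Symmetric R → Transitive R →
  ∀ {k m} → HasSize R k → HasSize R m → Σ (Fin k → Fin m) (Injective _≡_ _≡_)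
reindex {R = R} R-sym R-trans (f , f-injective , _) (g , _ , g-surjective) = index , index-injective
  where
  index : Fin _ → Fin _
  index a = proj₁ (g-surjective (f a))
  index-injective : Injective _≡_ _≡_ index
  index-injective {a} {a′} eq = f-injective a a′ (R-trans (R-sym (proj₂ (g-surjective (f a))))
    (subst (λ b → R (g b) (f a′)) (sym eq) (proj₂ (g-surjective (f a′)))))

HasSize-unique : {A : Set} {R : A → A → Set} → Symmetric R → Transitive R →
  ∀ {k m} → HasSize R k → HasSize R m → k ≡ m
HasSize-unique R-sym R-trans size-k size-m =
  cantor-schröder-bernstein (proj₂ (reindex R-sym R-trans size-k size-m))
                            (proj₂ (reindex R-sym R-trans size-m size-k))

lemma4p3 : (n : ℕ) → Prime n → (s : Tuple n) → n ∣ tupleSum s →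
    ¬ (∃₂ λ (σ : Permutation′ n) j → permute σ s ≈ₜ shift j standard) →
    ∀ k m → γ-is s k → classPerms-is s m → k ≡ m
lemma4p3 zero isPrime _ _ _ _ _ _ _ = ⊥-elim (NonZero.nonZero (prime⇒nonZero isPrime))
lemma4p3 (suc n) isPrime s _ ¬standard k m γ classes =
  HasSize-unique (λ t≈u i → sym (t≈u i)) (λ t≈u u≈v i → trans (t≈u i) (u≈v i)) γ
    (HasSize-transport (λ {p} {q} → same-class⇒equal isPrime s ¬standard p q) equal⇒same-class classes)
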